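{- Let $G=([n],E)$ be a graph and let $2\le k\le\lfloor n/2\rfloor$. For every $\phi\in\mathbb{R}^{\binom{n}{k}}$, \[ (k-1)\langle L_k(G)\phi,\phi\rangle=\left(\sum_{u=1}^n \langle L_{k-1}(G)\phi_u,\phi_u\rangle\right)-2\langle D_k\phi,\phi\rangle . \]
   Context: For $0\le j\le n$, the $j$-th token graph $F_j(G)$ has vertex set $\binom{[n]}{j}$ (the $j$-subsets of $[n]$), with $\{A,B\}$ an edge iff $|A\cap B|=j-1$ and $A\triangle B\in E$; $L_j(G)$ is the Laplacian matrix of $F_j(G)$ (degrees on the diagonal, $-1$ for adjacent pairs, $0$ otherwise), and vectors in $\mathbb{R}^{\binom{n}{j}}$ are indexed by $j$-subsets of $[n]$, with the standard inner product $\langle\cdot,\cdot\rangle$. For $\phi\in\mathbb{R}^{\binom{n}{k}}$ and $u\in[n]$, $\phi_u\in\mathbb{R}^{\binom{n}{k-1}}$ is defined by $\phi_u(\tau)=\phi(\tau\cup\{u\})$ if $u\notin\tau$ and $\phi_u(\tau)=0$ if $u\in\tau$, for $\tau\in\binom{[n]}{k-1}$. For $\sigma\in\binom{[n]}{k}$ let $E_\sigma=\{e\in E: e\subset\sigma\}$, and let $D_k$ be the diagonal $\binom{n}{k}\times\binom{n}{k}$ matrix with $(D_k)_{\sigma,\sigma}=|E_\sigma|$. -}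

module Defs where

open import Level using (Level)
open import Data.Bool using (Bool; true; false; _∧_; _xor_; if_then_else_; not)
open import Data.Nat using (ℕ; zero; suc; _≡ᵇ_; _∸_)
open import Data.Fin using (Fin)
open import Data.Vec using (Vec; []; _∷_; zipWith; lookup)
open import Data.List using (List; []; _∷_; _++_; map; filter; foldr)
open import Data.Fin.Subset using (Subset; ∣_∣; _∩_; _∪_; ⁅_⁆)
open import Relation.Nullary.Decidable using (does)
open import Relation.Binary.PropositionalEquality using (_≡_)
import Data.Vec.Properties as VP
import Data.Bool.Properties as BP
open import Algebra.Bundles using (CommutativeRing)

allSubsets : (n : ℕ) → List (Subset n)
allSubsets zero = [] ∷ []
allSubsets (suc n) = map (true ∷_) (allSubsets n) ++ map (false ∷_) (allSubsets n)

subsetsOfSize : (n j : ℕ) → List (Subset n)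
subsetsOfSize n j = filter (λ S → ∣ S ∣ Data.Nat.≟ j) (allSubsets n)

_==_ : {n : ℕ} → Subset n → Subset n → Bool
A == B = does (VP.≡-dec BP._≟_ A B)

_△_ : {n : ℕ} → Subset n → Subset n → Subset n
A △ B = zipWith _xor_ A B

record Graph (n : ℕ) : Set where
  field
    E      : Subset n → Bool
    E-size : (S : Subset n) → E S ≡ true → ∣ S ∣ ≡ 2
open Graph public

tokenAdj : {n : ℕ} → Graph n → ℕ → Subset n → Subset n → Bool
tokenAdj G j A B = (∣ A ∩ B ∣ ≡ᵇ (j ∸ 1)) ∧ E G (A △ B)

_⊆ᵇ_ : {n : ℕ} → Subset n → Subset n → Bool
S ⊆ᵇ σ = (S ∩ σ) == S

edgesIn : {n : ℕ} → Graph n → Subset n → ℕ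
edgesIn {n} G σ = Data.List.length (filter (λ e → BP.T? (E G e ∧ (e ⊆ᵇ σ))) (allSubsets n))

module _ {c ℓ : Level} (R : CommutativeRing c ℓ) where
  open CommutativeRing R

  fromℕ : ℕ → Carrier
  fromℕ zero = 0#
  fromℕ (suc m) = 1# + fromℕ m

  boolR : Bool → Carrier
  boolR true = 1#
  boolR false = 0#

  sumL : List Carrier → Carrier
  sumL = foldr _+_ 0#

  Σ[_,_] : (n j : ℕ) → (Subset n → Carrier) → Carrier
  Σ[ n , j ] f = sumL (map f (subsetsOfSize n j))

  Σfin : (n : ℕ) → (Fin n → Carrier) → Carrier
  Σfin n f = sumL (map f (Data.List.allFin n))

  -- vectors in R^(binom n j), indexed by j-subsets (values off j-subsets unused)
  RVec : ℕ → Set c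
  RVec n = Subset n → Carrier

  inner : (n j : ℕ) → RVec n → RVec n → Carrier
  inner n j x y = Σ[ n , j ] (λ A → x A * y A)

  tokenDeg : {n : ℕ} → Graph n → ℕ → Subset n → ℕ
  tokenDeg {n} G j A = Data.List.length (filter (λ B → BP.T? (tokenAdj G j A B)) (subsetsOfSize n j))

  Lmat : {n : ℕ} → Graph n → (j : ℕ) → Subset n → Subset n → Carrier
  Lmat G j A B =
    if A == B then fromℕ (tokenDeg G j A)
    else (if tokenAdj G j A B then - 1# else 0#)

  Lapply : {n : ℕ} → Graph n → (j : ℕ) → RVec n → RVec n
  Lapply {n} G j x A = Σ[ n , j ] (λ B → Lmat G j A B * x B)

  Dapply : {n : ℕ} → Graph n → RVec n → RVec n
  Dapply G x σ = fromℕ (edgesIn G σ) * x σ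

  restrict : {n : ℕ} → RVec n → Fin n → RVec n
  restrict φ u τ = if lookup τ u then 0# else φ (τ ∪ ⁅ u ⁆)

{-# OPTIONS --safe #-}

-- Both quadratic forms are sums over the edges e of G: the neighbours of a j-set A in F_j(G)
-- are the sets A △ e with e ∈ E and |A ∩ e| = 1, so
--   ⟨L_j x, x⟩ = Σ_e Σ_{|A| = j, |A ∩ e| = 1} (x_A − x_{A△e}) x_A,   ⟨D_k φ, φ⟩ = Σ_e Σ_{|σ| = k, e ⊆ σ} φ_σ².
-- Substituting σ = τ ∪ {u} in Σ_u ⟨L_{k−1} φ_u, φ_u⟩ turns the contribution of e into a sum over
-- σ and u ∈ σ. For u ∉ e the summand is the σ-term of ⟨L_k φ, φ⟩, and it occurs k − 1 times since
-- |σ ∖ e| = k − 1; for u ∈ e the term φ_u(τ △ e) vanishes because u ∈ τ △ e, leaving φ_σ², which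
-- occurs twice since e ⊆ σ.

module Submission where

open import Defs
open import Level using (Level)
open import Data.Bool using (Bool; true; false; not; _∧_; _xor_; if_then_else_)
open import Data.Bool.Properties
  using (∧-zeroʳ; ∧-identityʳ; ∧-conicalˡ; ∧-conicalʳ; not-involutive; xor-same; T-≡)
import Data.Bool.Properties as Bool
open import Data.Nat using (ℕ; zero; suc; _∸_; _≤_; _/_; _≡ᵇ_; _≟_; s≤s)
open import Data.Fin using (Fin; zero; suc)
open import Data.Vec using ([]; _∷_; lookup)
open import Data.Vec.Properties using (≡-dec; lookup-zipWith)
open import Data.List using (List; []; _∷_; _++_; map; filter; length; allFin)
open import Data.List.Properties using (map-tabulate)
open import Data.Fin.Subset using (Subset; ∣_∣; _∩_; _∪_; ⁅_⁆; ⊥; ∁)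
open import Data.Fin.Subset.Properties using (∪-identityʳ; ∣⊥∣≡0; ∣p∩q∣≤∣q∣)
open import Function using (_∘_; Equivalence)
open import Relation.Nullary using (yes; contradiction)
open import Relation.Nullary.Decidable using (does; dec-true; dec-false)
open import Relation.Unary using (Pred; Decidable)
open import Algebra.Bundles using (CommutativeRing)
import Relation.Binary.PropositionalEquality as ≡
open ≡ using (_≡_)

-- Subsets of [n]

module _ where
  open ≡ using (refl; cong; cong₂; sym; trans)
  open import Data.Nat using (_+_; z<s)
  open import Data.Nat.Properties
    using (+-suc; +-assoc; +-identityʳ; +-cancelʳ-≡; m+n∸n≡m; m<m+n; <⇒≢; ≡ᵇ⇒≡)

  ≡ᵇ-true⇒≡ : ∀ m n → (m ≡ᵇ n) ≡ true → m ≡ n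
  ≡ᵇ-true⇒≡ m n eq = ≡ᵇ⇒≡ m n (Equivalence.from T-≡ eq)

  ==⇒≡ : ∀ {n} {p q : Subset n} → p == q ≡ true → p ≡ q
  ==⇒≡ {p = p} {q} eq with ≡-dec Bool._≟_ p q
  ... | yes p≡q = p≡q

  p△p≡⊥ : ∀ {n} (p : Subset n) → p △ p ≡ ⊥
  p△p≡⊥ []      = refl
  p△p≡⊥ (b ∷ p) = cong₂ _∷_ (xor-same b) (p△p≡⊥ p)

  p△[p△q]≡q : ∀ {n} (p q : Subset n) → p △ (p △ q) ≡ q
  p△[p△q]≡q []          []      = refl
  p△[p△q]≡q (true ∷ p)  (b ∷ q) = cong₂ _∷_ (not-involutive b) (p△[p△q]≡q p q)
  p△[p△q]≡q (false ∷ p) (b ∷ q) = cong (b ∷_) (p△[p△q]≡q p q)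

  p∩[p△q]≡p∩∁q : ∀ {n} (p q : Subset n) → p ∩ (p △ q) ≡ p ∩ ∁ q
  p∩[p△q]≡p∩∁q []          []      = refl
  p∩[p△q]≡p∩∁q (true ∷ p)  (b ∷ q) = cong (not b ∷_) (p∩[p△q]≡p∩∁q p q)
  p∩[p△q]≡p∩∁q (false ∷ p) (b ∷ q) = cong (false ∷_) (p∩[p△q]≡p∩∁q p q)

  ∣p∩∁q∣+∣p∩q∣≡∣p∣ : ∀ {n} (p q : Subset n) → ∣ p ∩ ∁ q ∣ + ∣ p ∩ q ∣ ≡ ∣ p ∣
  ∣p∩∁q∣+∣p∩q∣≡∣p∣ []          []          = refl
  ∣p∩∁q∣+∣p∩q∣≡∣p∣ (true ∷ p)  (true ∷ q)  =
    trans (+-suc ∣ p ∩ ∁ q ∣ ∣ p ∩ q ∣) (cong suc (∣p∩∁q∣+∣p∩q∣≡∣p∣ p q))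
  ∣p∩∁q∣+∣p∩q∣≡∣p∣ (true ∷ p)  (false ∷ q) = cong suc (∣p∩∁q∣+∣p∩q∣≡∣p∣ p q)
  ∣p∩∁q∣+∣p∩q∣≡∣p∣ (false ∷ p) (b ∷ q)     = ∣p∩∁q∣+∣p∩q∣≡∣p∣ p q

  ∣p△q∣+∣p∩q∣+∣p∩q∣≡∣p∣+∣q∣ : ∀ {n} (p q : Subset n) →
                               ∣ p △ q ∣ + ∣ p ∩ q ∣ + ∣ p ∩ q ∣ ≡ ∣ p ∣ + ∣ q ∣
  ∣p△q∣+∣p∩q∣+∣p∩q∣≡∣p∣+∣q∣ []          []          = refl
  ∣p△q∣+∣p∩q∣+∣p∩q∣≡∣p∣+∣q∣ (true ∷ p)  (true ∷ q)  = begin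
    ∣ p △ q ∣ + suc c + suc c   ≡⟨ cong (_+ suc c) (+-suc ∣ p △ q ∣ c) ⟩
    suc (∣ p △ q ∣ + c + suc c) ≡⟨ cong suc (+-suc (∣ p △ q ∣ + c) c) ⟩
    suc (suc (∣ p △ q ∣ + c + c)) ≡⟨ cong (λ m → 2 + m) (∣p△q∣+∣p∩q∣+∣p∩q∣≡∣p∣+∣q∣ p q) ⟩
    suc (suc (∣ p ∣ + ∣ q ∣))   ≡⟨ cong suc (+-suc ∣ p ∣ ∣ q ∣) ⟨
    suc (∣ p ∣ + suc ∣ q ∣)     ∎
    where open ≡.≡-Reasoning
          c = ∣ p ∩ q ∣
  ∣p△q∣+∣p∩q∣+∣p∩q∣≡∣p∣+∣q∣ (true ∷ p)  (false ∷ q) = cong suc (∣p△q∣+∣p∩q∣+∣p∩q∣≡∣p∣+∣q∣ p q)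
  ∣p△q∣+∣p∩q∣+∣p∩q∣≡∣p∣+∣q∣ (false ∷ p) (true ∷ q)  =
    trans (cong suc (∣p△q∣+∣p∩q∣+∣p∩q∣≡∣p∣+∣q∣ p q)) (sym (+-suc ∣ p ∣ ∣ q ∣))
  ∣p△q∣+∣p∩q∣+∣p∩q∣≡∣p∣+∣q∣ (false ∷ p) (false ∷ q) = ∣p△q∣+∣p∩q∣+∣p∩q∣≡∣p∣+∣q∣ p q

  ∣p∩∁q∣≡∣p∣∸∣p∩q∣ : ∀ {n} (p q : Subset n) → ∣ p ∩ ∁ q ∣ ≡ ∣ p ∣ ∸ ∣ p ∩ q ∣
  ∣p∩∁q∣≡∣p∣∸∣p∩q∣ p q =
    trans (sym (m+n∸n≡m ∣ p ∩ ∁ q ∣ ∣ p ∩ q ∣)) (cong (_∸ ∣ p ∩ q ∣) (∣p∩∁q∣+∣p∩q∣≡∣p∣ p q))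

  q⊆ᵇp≡∣p∩q∣≡ᵇ∣q∣ : ∀ {n} (p q : Subset n) → (q ⊆ᵇ p) ≡ (∣ p ∩ q ∣ ≡ᵇ ∣ q ∣)
  q⊆ᵇp≡∣p∩q∣≡ᵇ∣q∣ []          []          = refl
  q⊆ᵇp≡∣p∩q∣≡ᵇ∣q∣ (true ∷ p)  (true ∷ q)  = q⊆ᵇp≡∣p∩q∣≡ᵇ∣q∣ p q
  q⊆ᵇp≡∣p∩q∣≡ᵇ∣q∣ (true ∷ p)  (false ∷ q) = q⊆ᵇp≡∣p∩q∣≡ᵇ∣q∣ p q
  q⊆ᵇp≡∣p∩q∣≡ᵇ∣q∣ (false ∷ p) (false ∷ q) = q⊆ᵇp≡∣p∩q∣≡ᵇ∣q∣ p q
  q⊆ᵇp≡∣p∩q∣≡ᵇ∣q∣ (false ∷ p) (true ∷ q)  =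
    sym (dec-false (∣ p ∩ q ∣ ≟ suc ∣ q ∣) (<⇒≢ (s≤s (∣p∩q∣≤∣q∣ p q))))

  lookup-p△q : ∀ {n} (p q : Subset n) (x : Fin n) → lookup p x ≡ false → lookup (p △ q) x ≡ lookup q x
  lookup-p△q p q x x∉p rewrite lookup-zipWith _xor_ x p q | x∉p = refl

  ∣p∪⁅x⁆∣≡1+∣p∣ : ∀ {n} (p : Subset n) (x : Fin n) → lookup p x ≡ false → ∣ p ∪ ⁅ x ⁆ ∣ ≡ suc ∣ p ∣
  ∣p∪⁅x⁆∣≡1+∣p∣ (false ∷ p) zero    _   = cong (λ r → suc ∣ r ∣) (∪-identityʳ p)
  ∣p∪⁅x⁆∣≡1+∣p∣ (true ∷ p)  (suc x) x∉p = cong suc (∣p∪⁅x⁆∣≡1+∣p∣ p x x∉p)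
  ∣p∪⁅x⁆∣≡1+∣p∣ (false ∷ p) (suc x) x∉p = ∣p∪⁅x⁆∣≡1+∣p∣ p x x∉p

  ∣[p∪⁅x⁆]∩q∣≡∣p∩q∣ : ∀ {n} (p q : Subset n) (x : Fin n) → lookup q x ≡ false →
                      ∣ (p ∪ ⁅ x ⁆) ∩ q ∣ ≡ ∣ p ∩ q ∣
  ∣[p∪⁅x⁆]∩q∣≡∣p∩q∣ (true ∷ p)  (false ∷ q) zero    _   = cong (λ r → ∣ r ∩ q ∣) (∪-identityʳ p)
  ∣[p∪⁅x⁆]∩q∣≡∣p∩q∣ (false ∷ p) (false ∷ q) zero    _   = cong (λ r → ∣ r ∩ q ∣) (∪-identityʳ p)
  ∣[p∪⁅x⁆]∩q∣≡∣p∩q∣ (true ∷ p)  (true ∷ q)  (suc x) x∉q = cong suc (∣[p∪⁅x⁆]∩q∣≡∣p∩q∣ p q x x∉q)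
  ∣[p∪⁅x⁆]∩q∣≡∣p∩q∣ (true ∷ p)  (false ∷ q) (suc x) x∉q = ∣[p∪⁅x⁆]∩q∣≡∣p∩q∣ p q x x∉q
  ∣[p∪⁅x⁆]∩q∣≡∣p∩q∣ (false ∷ p) (b ∷ q)     (suc x) x∉q = ∣[p∪⁅x⁆]∩q∣≡∣p∩q∣ p q x x∉q

  ∣[p∪⁅x⁆]∩q∣≡1+∣p∩q∣ : ∀ {n} (p q : Subset n) (x : Fin n) → lookup p x ≡ false → lookup q x ≡ true →
                        ∣ (p ∪ ⁅ x ⁆) ∩ q ∣ ≡ suc ∣ p ∩ q ∣
  ∣[p∪⁅x⁆]∩q∣≡1+∣p∩q∣ (false ∷ p) (true ∷ q)  zero    _   _   = cong (λ r → suc ∣ r ∩ q ∣) (∪-identityʳ p)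
  ∣[p∪⁅x⁆]∩q∣≡1+∣p∩q∣ (true ∷ p)  (true ∷ q)  (suc x) x∉p x∈q = cong suc (∣[p∪⁅x⁆]∩q∣≡1+∣p∩q∣ p q x x∉p x∈q)
  ∣[p∪⁅x⁆]∩q∣≡1+∣p∩q∣ (true ∷ p)  (false ∷ q) (suc x) x∉p x∈q = ∣[p∪⁅x⁆]∩q∣≡1+∣p∩q∣ p q x x∉p x∈q
  ∣[p∪⁅x⁆]∩q∣≡1+∣p∩q∣ (false ∷ p) (b ∷ q)     (suc x) x∉p x∈q = ∣[p∪⁅x⁆]∩q∣≡1+∣p∩q∣ p q x x∉p x∈q

  [p△q]∪⁅x⁆≡[p∪⁅x⁆]△q : ∀ {n} (p q : Subset n) (x : Fin n) → lookup p x ≡ false → lookup q x ≡ false →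
                        (p △ q) ∪ ⁅ x ⁆ ≡ (p ∪ ⁅ x ⁆) △ q
  [p△q]∪⁅x⁆≡[p∪⁅x⁆]△q (false ∷ p) (false ∷ q) zero _ _ =
    cong (true ∷_) (trans (∪-identityʳ (p △ q)) (cong (_△ q) (sym (∪-identityʳ p))))
  [p△q]∪⁅x⁆≡[p∪⁅x⁆]△q (true ∷ p)  (true ∷ q)  (suc x) x∉p x∉q =
    cong (false ∷_) ([p△q]∪⁅x⁆≡[p∪⁅x⁆]△q p q x x∉p x∉q)
  [p△q]∪⁅x⁆≡[p∪⁅x⁆]△q (true ∷ p)  (false ∷ q) (suc x) x∉p x∉q =
    cong (true ∷_) ([p△q]∪⁅x⁆≡[p∪⁅x⁆]△q p q x x∉p x∉q)
  [p△q]∪⁅x⁆≡[p∪⁅x⁆]△q (false ∷ p) (true ∷ q)  (suc x) x∉p x∉q =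
    cong (true ∷_) ([p△q]∪⁅x⁆≡[p∪⁅x⁆]△q p q x x∉p x∉q)
  [p△q]∪⁅x⁆≡[p∪⁅x⁆]△q (false ∷ p) (false ∷ q) (suc x) x∉p x∉q =
    cong (false ∷_) ([p△q]∪⁅x⁆≡[p∪⁅x⁆]△q p q x x∉p x∉q)

  E-⊥ : ∀ {n} (G : Graph n) → E G ⊥ ≡ false
  E-⊥ {n} G with E G ⊥ in ⊥∈E
  ... | false = refl
  ... | true  = contradiction (trans (sym (∣⊥∣≡0 n)) (E-size G ⊥ ⊥∈E)) λ ()

  tokenAdj-irrefl : ∀ {n} (G : Graph n) (j : ℕ) (p : Subset n) → tokenAdj G j p p ≡ false
  tokenAdj-irrefl G j p rewrite p△p≡⊥ p | E-⊥ G = ∧-zeroʳ _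

  △-edge-sizes : ∀ {n j} (p e : Subset n) → ∣ e ∣ ≡ 2 → ∣ p ∣ ≡ j →
                 (∣ p △ e ∣ ≡ᵇ j) ∧ (∣ p ∩ (p △ e) ∣ ≡ᵇ j ∸ 1) ≡ (∣ p ∩ e ∣ ≡ᵇ 1)
  △-edge-sizes p e ∣e∣≡2 refl = sizes
    (trans (∣p△q∣+∣p∩q∣+∣p∩q∣≡∣p∣+∣q∣ p e) (cong (∣ p ∣ +_) ∣e∣≡2))
    (trans (cong (λ r → ∣ r ∣ + ∣ p ∩ e ∣) (p∩[p△q]≡p∩∁q p e)) (∣p∩∁q∣+∣p∩q∣≡∣p∣ p e))
    (≡.subst (∣ p ∩ e ∣ ≤_) ∣e∣≡2 (∣p∩q∣≤∣q∣ p e))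
    where
    sizes : ∀ {a t c i} → t + c + c ≡ a + 2 → i + c ≡ a → c ≤ 2 → (t ≡ᵇ a) ∧ (i ≡ᵇ a ∸ 1) ≡ (c ≡ᵇ 1)
    sizes {a} {t} {0} {i} t≡a+2 _ _ =
      cong (_∧ (i ≡ᵇ a ∸ 1)) (dec-false (t ≟ a) λ t≡a → <⇒≢ (m<m+n a z<s) (trans (sym t≡a) t+0+0≡a+2))
      where t+0+0≡a+2 = trans (sym (trans (+-identityʳ (t + 0)) (+-identityʳ t))) t≡a+2
    sizes {a} {t} {1} {i} t+1+1≡a+2 i+1≡a _ = cong₂ _∧_
      (dec-true (t ≟ a) (+-cancelʳ-≡ 2 t a (trans (sym (+-assoc t 1 1)) t+1+1≡a+2)))
      (dec-true (i ≟ a ∸ 1) (trans (sym (m+n∸n≡m i 1)) (cong (_∸ 1) i+1≡a)))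
    sizes {a} {t} {2} {i} t+2+2≡a+2 _ _ =
      cong (_∧ (i ≡ᵇ a ∸ 1)) (dec-false (t ≟ a) λ t≡a → <⇒≢ (m<m+n t z<s) (sym (trans t+2≡a (sym t≡a))))
      where t+2≡a = +-cancelʳ-≡ 2 (t + 2) a t+2+2≡a+2
    sizes {c = suc (suc (suc _))} _ _ (s≤s (s≤s ()))

  tokenAdj-△ : ∀ {n} (G : Graph n) (j : ℕ) (p e : Subset n) →
               (∣ p ∣ ≡ᵇ j) ∧ ((∣ p △ e ∣ ≡ᵇ j) ∧ tokenAdj G j p (p △ e))
               ≡ E G e ∧ ((∣ p ∣ ≡ᵇ j) ∧ (∣ p ∩ e ∣ ≡ᵇ 1))
  tokenAdj-△ G j p e rewrite p△[p△q]≡q p e with E G e in e∈E | ∣ p ∣ ≡ᵇ j in ∣p∣≡j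
  ... | false | false = refl
  ... | false | true  =
    trans (cong ((∣ p △ e ∣ ≡ᵇ j) ∧_) (∧-zeroʳ (∣ p ∩ (p △ e) ∣ ≡ᵇ j ∸ 1))) (∧-zeroʳ (∣ p △ e ∣ ≡ᵇ j))
  ... | true  | false = refl
  ... | true  | true  =
    trans (cong ((∣ p △ e ∣ ≡ᵇ j) ∧_) (∧-identityʳ (∣ p ∩ (p △ e) ∣ ≡ᵇ j ∸ 1)))
          (△-edge-sizes p e (E-size G e e∈E) (≡ᵇ-true⇒≡ ∣ p ∣ j ∣p∣≡j))

  edge⊆ᵇ : ∀ {n} (G : Graph n) (e σ : Subset n) → E G e ∧ (e ⊆ᵇ σ) ≡ E G e ∧ (∣ σ ∩ e ∣ ≡ᵇ 2)
  edge⊆ᵇ G e σ with E G e in e∈E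
  ... | false = refl
  ... | true  = trans (q⊆ᵇp≡∣p∩q∣≡ᵇ∣q∣ σ e) (cong (∣ σ ∩ e ∣ ≡ᵇ_) (E-size G e e∈E))

-- Sums in a commutative ring

module _ {c ℓ : Level} (R : CommutativeRing c ℓ) where
  open CommutativeRing R hiding (zero)
  open import Relation.Binary.Reasoning.Setoid setoid
  open import Algebra.Properties.Ring ring using (-0#≈0#; x[y-z]≈xy-xz; [y-z]x≈yx-zx)
  open import Algebra.Properties.AbelianGroup +-abelianGroup using (⁻¹-∙-comm; xyx⁻¹≈y)
  open import Algebra.Properties.CommutativeSemigroup +-commutativeSemigroup
    using (interchange) renaming (x∙yz≈y∙xz to x+[y+z]≈y+[x+z])
  open import Algebra.Properties.CommutativeSemigroup *-commutativeSemigroup using (x∙yz≈y∙xz)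

  sumOver : ∀ {a} {A : Set a} → List A → (A → Carrier) → Carrier
  sumOver xs f = sumL R (map f xs)

  [_] : Bool → Carrier
  [_] = boolR R

  module _ {a} {A : Set a} where

    sumOver-cong : ∀ (xs : List A) {f g : A → Carrier} → (∀ x → f x ≈ g x) → sumOver xs f ≈ sumOver xs g
    sumOver-cong []       f≈g = refl
    sumOver-cong (x ∷ xs) f≈g = +-cong (f≈g x) (sumOver-cong xs f≈g)

    sumOver-++ : ∀ (xs ys : List A) f → sumOver (xs ++ ys) f ≈ sumOver xs f + sumOver ys f
    sumOver-++ []       ys f = sym (+-identityˡ _)
    sumOver-++ (x ∷ xs) ys f = trans (+-congˡ (sumOver-++ xs ys f)) (sym (+-assoc _ _ _))

    sumOver-0# : ∀ (xs : List A) → sumOver xs (λ _ → 0#) ≈ 0#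
    sumOver-0# []       = refl
    sumOver-0# (x ∷ xs) = trans (+-identityˡ _) (sumOver-0# xs)

    sumOver-+ : ∀ (xs : List A) f g → sumOver xs (λ x → f x + g x) ≈ sumOver xs f + sumOver xs g
    sumOver-+ []       f g = sym (+-identityˡ 0#)
    sumOver-+ (x ∷ xs) f g = trans (+-congˡ (sumOver-+ xs f g)) (interchange _ _ _ _)

    sumOver-- : ∀ (xs : List A) f g → sumOver xs (λ x → f x - g x) ≈ sumOver xs f - sumOver xs g
    sumOver-- []       f g = sym (trans (+-congˡ -0#≈0#) (+-identityʳ 0#))
    sumOver-- (x ∷ xs) f g =
      trans (+-congˡ (sumOver-- xs f g)) (trans (interchange _ _ _ _) (+-congˡ (⁻¹-∙-comm _ _)))

    *-distribˡ-sumOver : ∀ y (xs : List A) f → y * sumOver xs f ≈ sumOver xs (λ x → y * f x)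
    *-distribˡ-sumOver y []       f = zeroʳ y
    *-distribˡ-sumOver y (x ∷ xs) f = trans (distribˡ y _ _) (+-congˡ (*-distribˡ-sumOver y xs f))

    *-distribʳ-sumOver : ∀ y (xs : List A) f → sumOver xs f * y ≈ sumOver xs (λ x → f x * y)
    *-distribʳ-sumOver y []       f = zeroˡ y
    *-distribʳ-sumOver y (x ∷ xs) f = trans (distribʳ y _ _) (+-congˡ (*-distribʳ-sumOver y xs f))

    sumOver-filter : ∀ {p} {P : Pred A p} (P? : Decidable P) (xs : List A) f →
                     sumOver (filter P? xs) f ≈ sumOver xs (λ x → [ does (P? x) ] * f x)
    sumOver-filter P? []       f = refl
    sumOver-filter P? (x ∷ xs) f with does (P? x)
    ... | true  = +-cong (sym (*-identityˡ _)) (sumOver-filter P? xs f)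
    ... | false = trans (sumOver-filter P? xs f) (sym (trans (+-congʳ (zeroˡ _)) (+-identityˡ _)))

    fromℕ-length-filter : ∀ {p} {P : Pred A p} (P? : Decidable P) (xs : List A) →
                          fromℕ R (length (filter P? xs)) ≈ sumOver xs (λ x → [ does (P? x) ])
    fromℕ-length-filter P? []       = refl
    fromℕ-length-filter P? (x ∷ xs) with does (P? x)
    ... | true  = +-congˡ (fromℕ-length-filter P? xs)
    ... | false = trans (fromℕ-length-filter P? xs) (sym (+-identityˡ _))

    sumOver-map : ∀ {b} {B : Set b} (h : B → A) (xs : List B) f → sumOver (map h xs) f ≈ sumOver xs (f ∘ h)
    sumOver-map h []       f = refl
    sumOver-map h (x ∷ xs) f = +-congˡ (sumOver-map h xs f)

  sumOver-swap : ∀ {a b} {A : Set a} {B : Set b} (xs : List A) (ys : List B) (f : A → B → Carrier) →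
                 sumOver xs (λ x → sumOver ys (f x)) ≈ sumOver ys (λ y → sumOver xs (λ x → f x y))
  sumOver-swap []       ys f = sym (sumOver-0# ys)
  sumOver-swap (x ∷ xs) ys f =
    trans (+-congˡ (sumOver-swap xs ys f)) (sym (sumOver-+ ys (f x) (λ y → sumOver xs (λ x′ → f x′ y))))

  [∧] : ∀ a b → [ a ∧ b ] ≈ [ a ] * [ b ]
  [∧] true  b = sym (*-identityˡ _)
  [∧] false b = sym (zeroˡ _)

  [∧]* : ∀ a b x → [ a ∧ b ] * x ≈ [ a ] * ([ b ] * x)
  [∧]* a b x = trans (*-congʳ ([∧] a b)) (*-assoc _ _ _)

  []*-guard : ∀ b {x y} → (b ≡ true → x ≈ y) → [ b ] * x ≈ [ b ] * y
  []*-guard true  x≈y = *-congˡ (x≈y ≡.refl)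
  []*-guard false x≈y = trans (zeroˡ _) (sym (zeroˡ _))

  *[]*-guard : ∀ b {x y} z → (b ≡ true → x ≈ y) → x * ([ b ] * z) ≈ y * ([ b ] * z)
  *[]*-guard b {x} {y} z x≈y = begin
    x * ([ b ] * z) ≈⟨ x∙yz≈y∙xz x [ b ] z ⟩
    [ b ] * (x * z) ≈⟨ []*-guard b (λ b≡true → *-congʳ (x≈y b≡true)) ⟩
    [ b ] * (y * z) ≈⟨ x∙yz≈y∙xz y [ b ] z ⟨
    y * ([ b ] * z) ∎

  Σall : (n : ℕ) → (Subset n → Carrier) → Carrier
  Σall n = sumOver (allSubsets n)

  Σ[n,j]≈Σall : ∀ n j f → Σ[_,_] R n j f ≈ Σall n (λ A → [ ∣ A ∣ ≡ᵇ j ] * f A)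
  Σ[n,j]≈Σall n j = sumOver-filter (λ A → ∣ A ∣ ≟ j) (allSubsets n)

  Σall-suc : ∀ n f → Σall (suc n) f ≈ Σall n (f ∘ (true ∷_)) + Σall n (f ∘ (false ∷_))
  Σall-suc n f = trans (sumOver-++ (map (true ∷_) (allSubsets n)) _ f)
                       (+-cong (sumOver-map (true ∷_) (allSubsets n) f)
                               (sumOver-map (false ∷_) (allSubsets n) f))

  Σall-[false]* : ∀ n (g : Subset n → Carrier) → Σall n (λ A → [ false ] * g A) ≈ 0#
  Σall-[false]* n g = trans (sumOver-cong (allSubsets n) (λ A → zeroˡ (g A))) (sumOver-0# (allSubsets n))

  Σall-[==]* : ∀ n (A : Subset n) (g : Subset n → Carrier) → Σall n (λ B → [ A == B ] * g B) ≈ g A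
  Σall-[==]* zero    []          g = trans (+-identityʳ _) (*-identityˡ _)
  Σall-[==]* (suc n) (true ∷ A)  g =
    trans (Σall-suc n _) (trans (+-cong (Σall-[==]* n A (g ∘ (true ∷_))) (Σall-[false]* n (g ∘ (false ∷_))))
                                (+-identityʳ _))
  Σall-[==]* (suc n) (false ∷ A) g =
    trans (Σall-suc n _) (trans (+-cong (Σall-[false]* n (g ∘ (true ∷_))) (Σall-[==]* n A (g ∘ (false ∷_))))
                                (+-identityˡ _))

  Σall-△ : ∀ n (A : Subset n) (f : Subset n → Carrier) → Σall n f ≈ Σall n (λ B → f (A △ B))
  Σall-△ zero    []          f = refl
  Σall-△ (suc n) (false ∷ A) f = begin
    Σall (suc n) f ≈⟨ Σall-suc n f ⟩
    Σall n (f ∘ (true ∷_)) + Σall n (f ∘ (false ∷_))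
      ≈⟨ +-cong (Σall-△ n A (f ∘ (true ∷_))) (Σall-△ n A (f ∘ (false ∷_))) ⟩
    Σall n (λ B → f (true ∷ (A △ B))) + Σall n (λ B → f (false ∷ (A △ B))) ≈⟨ Σall-suc n _ ⟨
    Σall (suc n) (λ B → f ((false ∷ A) △ B)) ∎
  Σall-△ (suc n) (true ∷ A)  f = begin
    Σall (suc n) f ≈⟨ trans (Σall-suc n f) (+-comm _ _) ⟩
    Σall n (f ∘ (false ∷_)) + Σall n (f ∘ (true ∷_))
      ≈⟨ +-cong (Σall-△ n A (f ∘ (false ∷_))) (Σall-△ n A (f ∘ (true ∷_))) ⟩
    Σall n (λ B → f (false ∷ (A △ B))) + Σall n (λ B → f (true ∷ (A △ B))) ≈⟨ Σall-suc n _ ⟨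
    Σall (suc n) (λ B → f ((true ∷ A) △ B)) ∎

  Σall-∪⁅⁆ : ∀ n (u : Fin n) (F : Subset n → Carrier) →
             Σall n (λ τ → [ not (lookup τ u) ] * F (τ ∪ ⁅ u ⁆)) ≈ Σall n (λ σ → [ lookup σ u ] * F σ)
  Σall-∪⁅⁆ (suc n) zero    F = begin
    Σall (suc n) (λ τ → [ not (lookup τ zero) ] * F (τ ∪ ⁅ zero ⁆))
      ≈⟨ Σall-suc n _ ⟩
    Σall n (λ τ → [ false ] * F (true ∷ (τ ∪ ⊥))) + Σall n (λ τ → [ true ] * F (true ∷ (τ ∪ ⊥)))
      ≈⟨ +-cong (Σall-[false]* n _)
                (sumOver-cong (allSubsets n) λ τ →
                   *-congˡ (reflexive (≡.cong (F ∘ (true ∷_)) (∪-identityʳ τ)))) ⟩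
    0# + Σall n (λ σ → [ true ] * F (true ∷ σ))
      ≈⟨ trans (+-comm _ _) (+-congˡ (sym (Σall-[false]* n _))) ⟩
    Σall n (λ σ → [ true ] * F (true ∷ σ)) + Σall n (λ σ → [ false ] * F (false ∷ σ))
      ≈⟨ Σall-suc n _ ⟨
    Σall (suc n) (λ σ → [ lookup σ zero ] * F σ) ∎
  Σall-∪⁅⁆ (suc n) (suc u) F =
    trans (Σall-suc n _) (trans (+-cong (Σall-∪⁅⁆ n u (F ∘ (true ∷_))) (Σall-∪⁅⁆ n u (F ∘ (false ∷_))))
                                (sym (Σall-suc n _)))

  Σfin-suc : ∀ n (f : Fin (suc n) → Carrier) → Σfin R (suc n) f ≡ f zero + Σfin R n (f ∘ suc)
  Σfin-suc n f = ≡.cong (λ xs → f zero + sumL R xs)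
                        (≡.trans (map-tabulate suc f) (≡.sym (map-tabulate (λ i → i) (f ∘ suc))))

  Σfin-[]*if : ∀ {n} (p q : Subset n) (y z : Carrier) →
               Σfin R n (λ u → [ lookup p u ] * (if lookup q u then y else z))
               ≈ fromℕ R ∣ p ∩ q ∣ * y + fromℕ R ∣ p ∩ ∁ q ∣ * z
  Σfin-[]*if []          []          y z = sym (trans (+-cong (zeroˡ y) (zeroˡ z)) (+-identityˡ 0#))
  Σfin-[]*if {suc n} (true ∷ p) (true ∷ q) y z = begin
    _                                              ≡⟨ Σfin-suc n _ ⟩
    1# * y + _                                     ≈⟨ +-congˡ (Σfin-[]*if p q y z) ⟩
    1# * y + (fromℕ R ∣ p ∩ q ∣ * y + _)           ≈⟨ +-assoc _ _ _ ⟨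
    (1# * y + fromℕ R ∣ p ∩ q ∣ * y) + _           ≈⟨ +-congʳ (distribʳ y 1# _) ⟨
    (1# + fromℕ R ∣ p ∩ q ∣) * y + _               ∎
  Σfin-[]*if {suc n} (true ∷ p) (false ∷ q) y z = begin
    _                                              ≡⟨ Σfin-suc n _ ⟩
    1# * z + _                                     ≈⟨ +-congˡ (Σfin-[]*if p q y z) ⟩
    1# * z + (_ + fromℕ R ∣ p ∩ ∁ q ∣ * z)         ≈⟨ x+[y+z]≈y+[x+z] _ _ _ ⟩
    _ + (1# * z + fromℕ R ∣ p ∩ ∁ q ∣ * z)         ≈⟨ +-congˡ (distribʳ z 1# _) ⟨
    _ + (1# + fromℕ R ∣ p ∩ ∁ q ∣) * z             ∎
  Σfin-[]*if {suc n} (false ∷ p) (b ∷ q) y z = begin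
    _                                              ≡⟨ Σfin-suc n _ ⟩
    0# * _ + _                                     ≈⟨ trans (+-congʳ (zeroˡ _)) (+-identityˡ _) ⟩
    Σfin R n _                                     ≈⟨ Σfin-[]*if p q y z ⟩
    _                                              ∎

  -- Quadratic forms as sums over edges

  module _ {n : ℕ} where

    energyTerm : ℕ → RVec R n → Subset n → Subset n → Carrier
    energyTerm j x e A = [ (∣ A ∣ ≡ᵇ j) ∧ (∣ A ∩ e ∣ ≡ᵇ 1) ] * ((x A - x (A △ e)) * x A)

    massTerm : ℕ → RVec R n → Subset n → Subset n → Carrier
    massTerm k x e σ = [ (∣ σ ∣ ≡ᵇ k) ∧ (∣ σ ∩ e ∣ ≡ᵇ 2) ] * (x σ * x σ)

    edgeEnergy : ℕ → RVec R n → Subset n → Carrier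
    edgeEnergy j x e = Σall n (energyTerm j x e)

    edgeMass : ℕ → RVec R n → Subset n → Carrier
    edgeMass k x e = Σall n (massTerm k x e)

  module _ {n : ℕ} (G : Graph n) (j : ℕ) where

    Lmat≈deg-adj : ∀ A B → Lmat R G j A B ≈ [ A == B ] * fromℕ R (tokenDeg R G j A) - [ tokenAdj G j A B ]
    Lmat≈deg-adj A B with A == B in A=B
    ... | true with ==⇒≡ {p = A} {B} A=B
    ...   | ≡.refl rewrite tokenAdj-irrefl G j A =
      sym (trans (+-cong (*-identityˡ _) -0#≈0#) (+-identityʳ _))
    Lmat≈deg-adj A B | false with tokenAdj G j A B
    ...   | true  = sym (trans (+-congʳ (zeroˡ _)) (+-identityˡ _))
    ...   | false = sym (trans (+-cong (zeroˡ _) -0#≈0#) (+-identityˡ _))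

    tokenDeg≈Σall : ∀ A → fromℕ R (tokenDeg R G j A) ≈ Σall n (λ B → [ (∣ B ∣ ≡ᵇ j) ∧ tokenAdj G j A B ])
    tokenDeg≈Σall A = begin
      fromℕ R (tokenDeg R G j A)
        ≈⟨ fromℕ-length-filter (λ B → Bool.T? (tokenAdj G j A B)) (subsetsOfSize n j) ⟩
      Σ[_,_] R n j (λ B → [ tokenAdj G j A B ])
        ≈⟨ Σ[n,j]≈Σall n j _ ⟩
      Σall n (λ B → [ ∣ B ∣ ≡ᵇ j ] * [ tokenAdj G j A B ])
        ≈⟨ sumOver-cong (allSubsets n) (λ B → [∧] (∣ B ∣ ≡ᵇ j) (tokenAdj G j A B)) ⟨
      Σall n (λ B → [ (∣ B ∣ ≡ᵇ j) ∧ tokenAdj G j A B ]) ∎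

    Lapply≈ : ∀ x A → Lapply R G j x A ≈ [ ∣ A ∣ ≡ᵇ j ] * (fromℕ R (tokenDeg R G j A) * x A)
                                        - Σall n (λ B → [ (∣ B ∣ ≡ᵇ j) ∧ tokenAdj G j A B ] * x B)
    Lapply≈ x A = begin
      Lapply R G j x A
        ≈⟨ Σ[n,j]≈Σall n j _ ⟩
      Σall n (λ B → [ ∣ B ∣ ≡ᵇ j ] * (Lmat R G j A B * x B))
        ≈⟨ sumOver-cong (allSubsets n) entry ⟩
      Σall n (λ B → [ A == B ] * ([ ∣ B ∣ ≡ᵇ j ] * (d * x B)) - [ (∣ B ∣ ≡ᵇ j) ∧ tokenAdj G j A B ] * x B)
        ≈⟨ sumOver-- (allSubsets n) _ _ ⟩
      Σall n (λ B → [ A == B ] * ([ ∣ B ∣ ≡ᵇ j ] * (d * x B))) - _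
        ≈⟨ +-congʳ (Σall-[==]* n A _) ⟩
      [ ∣ A ∣ ≡ᵇ j ] * (d * x A) - _ ∎
      where
      d = fromℕ R (tokenDeg R G j A)
      entry : ∀ B → [ ∣ B ∣ ≡ᵇ j ] * (Lmat R G j A B * x B)
                    ≈ [ A == B ] * ([ ∣ B ∣ ≡ᵇ j ] * (d * x B)) - [ (∣ B ∣ ≡ᵇ j) ∧ tokenAdj G j A B ] * x B
      entry B = begin
        [ ∣ B ∣ ≡ᵇ j ] * (Lmat R G j A B * x B)
          ≈⟨ *-congˡ (trans (*-congʳ (Lmat≈deg-adj A B)) ([y-z]x≈yx-zx _ _ _)) ⟩
        [ ∣ B ∣ ≡ᵇ j ] * ([ A == B ] * d * x B - [ tokenAdj G j A B ] * x B)
          ≈⟨ x[y-z]≈xy-xz _ _ _ ⟩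
        [ ∣ B ∣ ≡ᵇ j ] * ([ A == B ] * d * x B) - [ ∣ B ∣ ≡ᵇ j ] * ([ tokenAdj G j A B ] * x B)
          ≈⟨ +-cong (trans (x∙yz≈y∙xz _ _ _) (*-congˡ (sym (*-assoc _ _ _))))
                    (-‿cong ([∧]* (∣ B ∣ ≡ᵇ j) (tokenAdj G j A B) (x B))) ⟨
        [ A == B ] * ([ ∣ B ∣ ≡ᵇ j ] * (d * x B)) - [ (∣ B ∣ ≡ᵇ j) ∧ tokenAdj G j A B ] * x B ∎

    Lapply-row : ∀ x A → (∣ A ∣ ≡ᵇ j) ≡ true →
                 Lapply R G j x A * x A
                 ≈ Σall n (λ B → [ (∣ B ∣ ≡ᵇ j) ∧ tokenAdj G j A B ] * ((x A - x B) * x A))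
    Lapply-row x A ∣A∣≡j = begin
      Lapply R G j x A * x A
        ≈⟨ *-congʳ (trans (Lapply≈ x A) (+-congʳ (reflexive (≡.cong (λ b → [ b ] * (d * x A)) ∣A∣≡j)))) ⟩
      (1# * (d * x A) - Σall n (λ B → w B * x B)) * x A
        ≈⟨ trans ([y-z]x≈yx-zx _ _ _) (+-congʳ (*-congʳ (*-identityˡ _))) ⟩
      d * x A * x A - Σall n (λ B → w B * x B) * x A
        ≈⟨ +-cong (trans (*-assoc _ _ _)
                         (trans (*-congʳ (tokenDeg≈Σall A)) (*-distribʳ-sumOver _ (allSubsets n) _)))
                  (-‿cong (*-distribʳ-sumOver _ (allSubsets n) _)) ⟩
      Σall n (λ B → w B * (x A * x A)) - Σall n (λ B → w B * x B * x A)
        ≈⟨ sumOver-- (allSubsets n) _ _ ⟨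
      Σall n (λ B → w B * (x A * x A) - w B * x B * x A)
        ≈⟨ sumOver-cong (allSubsets n) (λ B →
             trans (+-congˡ (-‿cong (*-assoc _ _ _)))
                   (trans (sym (x[y-z]≈xy-xz _ _ _)) (*-congˡ (sym ([y-z]x≈yx-zx _ _ _))))) ⟩
      Σall n (λ B → w B * ((x A - x B) * x A)) ∎
      where
      d = fromℕ R (tokenDeg R G j A)
      w : Subset n → Carrier
      w B = [ (∣ B ∣ ≡ᵇ j) ∧ tokenAdj G j A B ]

    Lapply-quadratic : ∀ x → inner R n j (Lapply R G j x) x ≈ Σall n (λ e → [ E G e ] * edgeEnergy j x e)
    Lapply-quadratic x = begin
      inner R n j (Lapply R G j x) x
        ≈⟨ Σ[n,j]≈Σall n j _ ⟩
      Σall n (λ A → [ ∣ A ∣ ≡ᵇ j ] * (Lapply R G j x A * x A))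
        ≈⟨ sumOver-cong (allSubsets n) (λ A → []*-guard (∣ A ∣ ≡ᵇ j) (Lapply-row x A)) ⟩
      Σall n (λ A → [ ∣ A ∣ ≡ᵇ j ] * Σall n (λ B → w A B * ((x A - x B) * x A)))
        ≈⟨ sumOver-cong (allSubsets n) (λ A → trans (*-congˡ (Σall-△ n A _))
                                                    (*-distribˡ-sumOver _ (allSubsets n) _)) ⟩
      Σall n (λ A → Σall n (λ e → [ ∣ A ∣ ≡ᵇ j ] * (w A (A △ e) * ((x A - x (A △ e)) * x A))))
        ≈⟨ sumOver-cong (allSubsets n) (λ A → sumOver-cong (allSubsets n) (across-edge A)) ⟩
      Σall n (λ A → Σall n (λ e → [ E G e ] * energyTerm j x e A))
        ≈⟨ sumOver-swap (allSubsets n) (allSubsets n) _ ⟩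
      Σall n (λ e → Σall n (λ A → [ E G e ] * energyTerm j x e A))
        ≈⟨ sumOver-cong (allSubsets n) (λ e → *-distribˡ-sumOver [ E G e ] (allSubsets n) _) ⟨
      Σall n (λ e → [ E G e ] * edgeEnergy j x e) ∎
      where
      w : Subset n → Subset n → Carrier
      w A B = [ (∣ B ∣ ≡ᵇ j) ∧ tokenAdj G j A B ]
      across-edge : ∀ A e → [ ∣ A ∣ ≡ᵇ j ] * (w A (A △ e) * ((x A - x (A △ e)) * x A))
                            ≈ [ E G e ] * energyTerm j x e A
      across-edge A e = begin
        [ ∣ A ∣ ≡ᵇ j ] * ([ b ] * y)               ≈⟨ [∧]* (∣ A ∣ ≡ᵇ j) b y ⟨
        [ (∣ A ∣ ≡ᵇ j) ∧ b ] * y                   ≡⟨ ≡.cong (λ c → [ c ] * y) (tokenAdj-△ G j A e) ⟩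
        [ E G e ∧ ((∣ A ∣ ≡ᵇ j) ∧ (∣ A ∩ e ∣ ≡ᵇ 1)) ] * y ≈⟨ [∧]* (E G e) _ y ⟩
        [ E G e ] * energyTerm j x e A             ∎
        where
        b = (∣ A △ e ∣ ≡ᵇ j) ∧ tokenAdj G j A (A △ e)
        y = (x A - x (A △ e)) * x A

  module _ {n : ℕ} (G : Graph n) (k : ℕ) where

    Dapply-quadratic : ∀ φ → inner R n k (Dapply R G φ) φ ≈ Σall n (λ e → [ E G e ] * edgeMass k φ e)
    Dapply-quadratic φ = begin
      inner R n k (Dapply R G φ) φ
        ≈⟨ Σ[n,j]≈Σall n k _ ⟩
      Σall n (λ σ → [ ∣ σ ∣ ≡ᵇ k ] * (fromℕ R (edgesIn G σ) * φ σ * φ σ))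
        ≈⟨ sumOver-cong (allSubsets n) per-σ ⟩
      Σall n (λ σ → Σall n (λ e → [ E G e ] * massTerm k φ e σ))
        ≈⟨ sumOver-swap (allSubsets n) (allSubsets n) _ ⟩
      Σall n (λ e → Σall n (λ σ → [ E G e ] * massTerm k φ e σ))
        ≈⟨ sumOver-cong (allSubsets n) (λ e → *-distribˡ-sumOver [ E G e ] (allSubsets n) _) ⟨
      Σall n (λ e → [ E G e ] * edgeMass k φ e) ∎
      where
      per-σ : ∀ σ → [ ∣ σ ∣ ≡ᵇ k ] * (fromℕ R (edgesIn G σ) * φ σ * φ σ)
                    ≈ Σall n (λ e → [ E G e ] * massTerm k φ e σ)
      per-σ σ = begin
        [ ∣ σ ∣ ≡ᵇ k ] * (fromℕ R (edgesIn G σ) * φ σ * φ σ)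
          ≈⟨ *-congˡ (trans (*-assoc _ _ _)
                            (*-congʳ (fromℕ-length-filter (λ e → Bool.T? (E G e ∧ (e ⊆ᵇ σ))) (allSubsets n)))) ⟩
        [ ∣ σ ∣ ≡ᵇ k ] * (Σall n (λ e → [ E G e ∧ (e ⊆ᵇ σ) ]) * (φ σ * φ σ))
          ≈⟨ trans (*-congˡ (*-distribʳ-sumOver _ (allSubsets n) _)) (*-distribˡ-sumOver _ (allSubsets n) _) ⟩
        Σall n (λ e → [ ∣ σ ∣ ≡ᵇ k ] * ([ E G e ∧ (e ⊆ᵇ σ) ] * (φ σ * φ σ)))
          ≈⟨ sumOver-cong (allSubsets n) contained ⟩
        Σall n (λ e → [ E G e ] * massTerm k φ e σ) ∎
        where
        contained : ∀ e → [ ∣ σ ∣ ≡ᵇ k ] * ([ E G e ∧ (e ⊆ᵇ σ) ] * (φ σ * φ σ)) ≈ [ E G e ] * massTerm k φ e σ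
        contained e = begin
          [ ∣ σ ∣ ≡ᵇ k ] * ([ E G e ∧ (e ⊆ᵇ σ) ] * (φ σ * φ σ))
            ≡⟨ ≡.cong (λ c → [ ∣ σ ∣ ≡ᵇ k ] * ([ c ] * (φ σ * φ σ))) (edge⊆ᵇ G e σ) ⟩
          [ ∣ σ ∣ ≡ᵇ k ] * ([ E G e ∧ (∣ σ ∩ e ∣ ≡ᵇ 2) ] * (φ σ * φ σ))
            ≈⟨ *-congˡ ([∧]* (E G e) _ _) ⟩
          [ ∣ σ ∣ ≡ᵇ k ] * ([ E G e ] * ([ ∣ σ ∩ e ∣ ≡ᵇ 2 ] * (φ σ * φ σ)))
            ≈⟨ x∙yz≈y∙xz _ _ _ ⟩
          [ E G e ] * ([ ∣ σ ∣ ≡ᵇ k ] * ([ ∣ σ ∩ e ∣ ≡ᵇ 2 ] * (φ σ * φ σ)))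
            ≈⟨ *-congˡ ([∧]* (∣ σ ∣ ≡ᵇ k) _ _) ⟨
          [ E G e ] * massTerm k φ e σ ∎

  module _ {n : ℕ} (j : ℕ) (φ : RVec R n) (e : Subset n) where

    restrict-energyTerm :
      ∀ u τ → energyTerm j (restrict R φ u) e τ
              ≈ [ not (lookup τ u) ] * (if lookup e u then massTerm (suc j) φ e (τ ∪ ⁅ u ⁆)
                                                      else energyTerm (suc j) φ e (τ ∪ ⁅ u ⁆))
    restrict-energyTerm u τ with lookup τ u in τ[u]
    ... | true  = trans (*-congˡ (zeroʳ _)) (trans (zeroʳ _) (sym (zeroˡ _)))
    ... | false rewrite lookup-p△q τ e u τ[u] with lookup e u in e[u]
    ...   | false rewrite [p△q]∪⁅x⁆≡[p∪⁅x⁆]△q τ e u τ[u] e[u]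
                        | ∣p∪⁅x⁆∣≡1+∣p∣ τ u τ[u]
                        | ∣[p∪⁅x⁆]∩q∣≡∣p∩q∣ τ e u e[u] = sym (*-identityˡ _)
    ...   | true  rewrite ∣p∪⁅x⁆∣≡1+∣p∣ τ u τ[u]
                        | ∣[p∪⁅x⁆]∩q∣≡1+∣p∩q∣ τ e u τ[u] e[u] =
      trans (*-congˡ (*-congʳ (trans (+-congˡ -0#≈0#) (+-identityʳ _)))) (sym (*-identityˡ _))

    Σfin-restrict-edgeEnergy :
      Σfin R n (λ u → edgeEnergy j (restrict R φ u) e)
      ≈ fromℕ R 2 * edgeMass (suc j) φ e + fromℕ R j * edgeEnergy (suc j) φ e
    Σfin-restrict-edgeEnergy = begin
      Σfin R n (λ u → edgeEnergy j (restrict R φ u) e)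
        ≈⟨ sumOver-cong (allFin n) (λ u → sumOver-cong (allSubsets n) (restrict-energyTerm u)) ⟩
      Σfin R n (λ u → Σall n (λ τ → [ not (lookup τ u) ] * H u (τ ∪ ⁅ u ⁆)))
        ≈⟨ sumOver-cong (allFin n) (λ u → Σall-∪⁅⁆ n u (H u)) ⟩
      Σfin R n (λ u → Σall n (λ σ → [ lookup σ u ] * H u σ))
        ≈⟨ sumOver-swap (allFin n) (allSubsets n) _ ⟩
      Σall n (λ σ → Σfin R n (λ u → [ lookup σ u ] * H u σ))
        ≈⟨ sumOver-cong (allSubsets n) (λ σ → trans (Σfin-[]*if σ e _ _) (+-cong (mass σ) (energy σ))) ⟩
      Σall n (λ σ → fromℕ R 2 * massTerm (suc j) φ e σ + fromℕ R j * energyTerm (suc j) φ e σ)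
        ≈⟨ sumOver-+ (allSubsets n) _ _ ⟩
      Σall n (λ σ → fromℕ R 2 * massTerm (suc j) φ e σ) + Σall n (λ σ → fromℕ R j * energyTerm (suc j) φ e σ)
        ≈⟨ +-cong (*-distribˡ-sumOver _ (allSubsets n) _) (*-distribˡ-sumOver _ (allSubsets n) _) ⟨
      fromℕ R 2 * edgeMass (suc j) φ e + fromℕ R j * edgeEnergy (suc j) φ e ∎
      where
      H : Fin n → Subset n → Carrier
      H u σ = if lookup e u then massTerm (suc j) φ e σ else energyTerm (suc j) φ e σ
      mass : ∀ σ → fromℕ R ∣ σ ∩ e ∣ * massTerm (suc j) φ e σ ≈ fromℕ R 2 * massTerm (suc j) φ e σ
      mass σ = *[]*-guard (a ∧ b) (φ σ * φ σ) λ g →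
        reflexive (≡.cong (fromℕ R) (≡ᵇ-true⇒≡ ∣ σ ∩ e ∣ 2 (∧-conicalʳ a b g)))
        where a = ∣ σ ∣ ≡ᵇ suc j
              b = ∣ σ ∩ e ∣ ≡ᵇ 2
      energy : ∀ σ → fromℕ R ∣ σ ∩ ∁ e ∣ * energyTerm (suc j) φ e σ ≈ fromℕ R j * energyTerm (suc j) φ e σ
      energy σ = *[]*-guard (a ∧ b) ((φ σ - φ (σ △ e)) * φ σ) λ g →
        reflexive (≡.cong (fromℕ R) (≡.trans (∣p∩∁q∣≡∣p∣∸∣p∩q∣ σ e)
          (≡.cong₂ _∸_ (≡ᵇ-true⇒≡ ∣ σ ∣ (suc j) (∧-conicalˡ a b g))
                       (≡ᵇ-true⇒≡ ∣ σ ∩ e ∣ 1 (∧-conicalʳ a b g)))))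
        where a = ∣ σ ∣ ≡ᵇ suc j
              b = ∣ σ ∩ e ∣ ≡ᵇ 1

  tokenLaplacian-recurrence : ∀ {n} (G : Graph n) j φ →
    fromℕ R j * inner R n (suc j) (Lapply R G (suc j) φ) φ
    ≈ Σfin R n (λ u → inner R n j (Lapply R G j (restrict R φ u)) (restrict R φ u))
      - fromℕ R 2 * inner R n (suc j) (Dapply R G φ) φ
  tokenLaplacian-recurrence {n} G j φ = sym (begin
    Σfin R n (λ u → inner R n j (Lapply R G j (φ↾ u)) (φ↾ u))
      - fromℕ R 2 * inner R n (suc j) (Dapply R G φ) φ
      ≈⟨ +-cong (sumOver-cong (allFin n) (λ u → Lapply-quadratic G j (φ↾ u)))
                (-‿cong (*-congˡ (Dapply-quadratic G (suc j) φ))) ⟩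
    Σfin R n (λ u → Σall n (λ e → [ E G e ] * edgeEnergy j (φ↾ u) e))
      - fromℕ R 2 * Σall n (λ e → [ E G e ] * edgeMass (suc j) φ e)
      ≈⟨ +-cong (trans (sumOver-swap (allFin n) (allSubsets n) _)
                       (sumOver-cong (allSubsets n) λ e → sym (*-distribˡ-sumOver _ (allFin n) _)))
                (-‿cong (trans (*-distribˡ-sumOver _ (allSubsets n) _)
                               (sumOver-cong (allSubsets n) λ e → x∙yz≈y∙xz _ _ _))) ⟩
    Σall n (λ e → [ E G e ] * Σfin R n (λ u → edgeEnergy j (φ↾ u) e))
      - Σall n (λ e → [ E G e ] * (fromℕ R 2 * edgeMass (suc j) φ e))
      ≈⟨ sumOver-- (allSubsets n) _ _ ⟨
    Σall n (λ e → [ E G e ] * Σfin R n (λ u → edgeEnergy j (φ↾ u) e)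
                  - [ E G e ] * (fromℕ R 2 * edgeMass (suc j) φ e))
      ≈⟨ sumOver-cong (allSubsets n) (λ e → trans (sym (x[y-z]≈xy-xz _ _ _))
           (*-congˡ (trans (+-congʳ (Σfin-restrict-edgeEnergy j φ e)) (xyx⁻¹≈y _ _)))) ⟩
    Σall n (λ e → [ E G e ] * (fromℕ R j * edgeEnergy (suc j) φ e))
      ≈⟨ trans (sumOver-cong (allSubsets n) λ e → x∙yz≈y∙xz _ _ _)
               (sym (*-distribˡ-sumOver _ (allSubsets n) _)) ⟩
    fromℕ R j * Σall n (λ e → [ E G e ] * edgeEnergy (suc j) φ e)
      ≈⟨ *-congˡ (Lapply-quadratic G (suc j) φ) ⟨
    fromℕ R j * inner R n (suc j) (Lapply R G (suc j) φ) φ ∎)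
    where
    φ↾ : Fin n → RVec R n
    φ↾ = restrict R φ

-- The identity holds for every k ≥ 1.
proposition3p1 : {c ℓ : Level} (R : CommutativeRing c ℓ) (n : ℕ) (G : Graph n) (k : ℕ) →
    2 ≤ k → k ≤ n / 2 → (φ : RVec R n) →
    CommutativeRing._≈_ R
      (CommutativeRing._*_ R (fromℕ R (k ∸ 1)) (inner R n k (Lapply R G k φ) φ))
      (CommutativeRing._-_ R
        (Σfin R n (λ u → inner R n (k ∸ 1) (Lapply R G (k ∸ 1) (restrict R φ u)) (restrict R φ u)))
        (CommutativeRing._*_ R (fromℕ R 2) (inner R n k (Dapply R G φ) φ)))
proposition3p1 R n G (suc j) (s≤s _) _ φ = tokenLaplacian-recurrence R G j φ
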